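{- Let $\alpha$ and $n$ be positive integers with $\alpha\le n\le 2\alpha$. Then the maximum number of sets in an hke collection $F$ with $\alpha(F)=\alpha$ and $|\bigcup F|=n$ equals $2^{n-\alpha}$.
   Context: A non-empty finite collection $F$ of finite sets is an \emph{hke collection} if there is a positive integer $\alpha$ such that $|\bigcup \Gamma|+|\bigcap \Gamma|=2\alpha$ for every non-empty subcollection $\Gamma\subseteq F$; this $\alpha$ is denoted $\alpha(F)$. -}

module Defs where

open import Data.Nat using (ℕ; zero; suc; _+_; _*_; _≥_)
open import Data.Bool using (Bool; true; false)
open import Data.Vec using (_∷_; [])
open import Data.Fin using (Fin)
import Data.Fin as F
open import Data.Fin.Subset using (Subset; ⊥; ⊤; _∪_; _∩_; ∣_∣; Nonempty)
open import Function.Definitions using (Injective)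
open import Relation.Binary.PropositionalEquality using (_≡_)
open import Data.Product using (_×_)

-- A finite collection of k distinct finite sets, all contained in the
-- universe Fin m, is an injective family  F : Fin k → Subset m.
-- A subcollection Γ ⊆ F is given by a subset of the index set Fin k.

bigUnion : ∀ {k m} → (Fin k → Subset m) → Subset k → Subset m
bigUnion {zero}  F []            = ⊥
bigUnion {suc k} F (true  ∷ Γ)   = F F.zero ∪ bigUnion (λ i → F (F.suc i)) Γ
bigUnion {suc k} F (false ∷ Γ)   = bigUnion (λ i → F (F.suc i)) Γ

-- ⋂ Γ : intersection of the members F i with i ∈ Γ (only used for Γ nonempty)
bigInter : ∀ {k m} → (Fin k → Subset m) → Subset k → Subset m
bigInter {zero}  F []            = ⊤
bigInter {suc k} F (true  ∷ Γ)   = F F.zero ∩ bigInter (λ i → F (F.suc i)) Γ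
bigInter {suc k} F (false ∷ Γ)   = bigInter (λ i → F (F.suc i)) Γ

IsHKEWith : ∀ {k m} → (Fin k → Subset m) → ℕ → Set
IsHKEWith {k} {m} F α =
  Injective _≡_ _≡_ F × k ≥ 1 × α ≥ 1 ×
  ((Γ : Subset k) → Nonempty Γ → ∣ bigUnion F Γ ∣ + ∣ bigInter F Γ ∣ ≡ 2 * α)

unionSize : ∀ {k m} → (Fin k → Subset m) → ℕ
unionSize F = ∣ bigUnion F ⊤ ∣

-- Upper bound: for nonempty Γ ⊆ F one has |Γ| ≤ 2^(|⋃Γ| − α), by strong induction on |⋃Γ|.
-- If ⋃Γ = ⋂Γ all members of Γ coincide, so |Γ| ≤ 1. Otherwise pick x ∈ ⋃Γ ∖ ⋂Γ and split Γ
-- into the members containing x and those missing it. Both parts are nonempty and have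
-- strictly smaller union: the second misses x, and the first has strictly larger
-- intersection, which the identity |⋃| + |⋂| = 2α turns into a strictly smaller union.
-- Moreover ⋂Γ ⊊ ⋃Γ gives |⋃Γ| > α, and the two induction hypotheses add up.
--
-- Lower bound: with d = n − α and c = α − d, take every B ⊆ [d] and form the set
-- [c] ⊔ B ⊔ ([d] ∖ B), the complement living in a second copy of [d]. Complementation swaps
-- unions and intersections, so |⋃Γ| + |⋂Γ| = 2c + 2d = 2α for every nonempty Γ, while the
-- whole collection covers c + 2d = n points.

module Submission where

open import Defs
open import Data.Nat using (ℕ; zero; suc; _+_; _≤_; _<_; _*_; _∸_; _^_; _≥_; z≤n; s≤s)
open import Data.Nat.Properties
open import Data.Nat.Induction using (<-rec)
open import Data.Nat.Solver using (module +-*-Solver)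
open import Data.Bool using (true; false)
open import Data.Vec using (_∷_; []; _++_; lookup; tabulate; here; there)
open import Data.Vec.Properties
  using (lookup∘tabulate; tabulate∘lookup; tabulate-cong; []=⇒lookup; lookup⇒[]=; zipWith-++; ++-injective)
open import Data.Fin using (Fin; finToFun; funToFin; combine) renaming (zero to fzero; suc to fsuc)
open import Data.Fin.Properties using (¬∀⟶∃¬; 2↔Bool; funToFin-finToFin; finToFun-funToFin)
import Data.Fin.Properties as Finₚ
open import Data.Fin.Subset
  using (Subset; ⊥; ⊤; _∪_; _∩_; ∁; ∣_∣; Nonempty; _∈_; _∉_; _⊆_; _⊈_; _⊂_)
open import Data.Fin.Subset.Properties
open import Data.Product using (Σ; _×_; _,_; proj₁; proj₂; ∃-syntax)
open import Data.Sum using (inj₁; inj₂)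
open import Function using (_∘_; case_of_; Inverse)
open import Function.Definitions using (Injective)
open import Relation.Nullary using (yes; no; contradiction)
open import Relation.Nullary.Decidable using (_→-dec_)
open import Relation.Binary.PropositionalEquality

⊈⇒∃∈∉ : ∀ {n} {p q : Subset n} → p ⊈ q → ∃[ x ] x ∈ p × x ∉ q
⊈⇒∃∈∉ {n} {p} {q} p⊈q
  with ¬∀⟶∃¬ n (λ x → x ∈ p → x ∈ q) (λ x → x ∈? p →-dec x ∈? q) (λ p⊆q → p⊈q (p⊆q _))
... | x , x∈p⇏x∈q with x ∈? p
...   | yes x∈p = x , x∈p , λ x∈q → x∈p⇏x∈q (λ _ → x∈q)
...   | no x∉p  = contradiction (λ x∈p → contradiction x∈p x∉p) x∈p⇏x∈q

∣p∣≡∣p∩q∣+∣p∩∁q∣ : ∀ {n} (p q : Subset n) → ∣ p ∣ ≡ ∣ p ∩ q ∣ + ∣ p ∩ ∁ q ∣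
∣p∣≡∣p∩q∣+∣p∩∁q∣ []          []          = refl
∣p∣≡∣p∩q∣+∣p∩∁q∣ (true  ∷ p) (true  ∷ q) = cong suc (∣p∣≡∣p∩q∣+∣p∩∁q∣ p q)
∣p∣≡∣p∩q∣+∣p∩∁q∣ (true  ∷ p) (false ∷ q) = trans (cong suc (∣p∣≡∣p∩q∣+∣p∩∁q∣ p q)) (sym (+-suc _ _))
∣p∣≡∣p∩q∣+∣p∩∁q∣ (false ∷ p) (_     ∷ q) = ∣p∣≡∣p∩q∣+∣p∩∁q∣ p q

∣p++q∣≡∣p∣+∣q∣ : ∀ {a b} (p : Subset a) (q : Subset b) → ∣ p ++ q ∣ ≡ ∣ p ∣ + ∣ q ∣
∣p++q∣≡∣p∣+∣q∣ []          q = refl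
∣p++q∣≡∣p∣+∣q∣ (true  ∷ p) q = cong suc (∣p++q∣≡∣p∣+∣q∣ p q)
∣p++q∣≡∣p∣+∣q∣ (false ∷ p) q = ∣p++q∣≡∣p∣+∣q∣ p q

⊥++⊥≡⊥ : ∀ a {b} → ⊥ {a} ++ ⊥ {b} ≡ ⊥
⊥++⊥≡⊥ zero    = refl
⊥++⊥≡⊥ (suc a) = cong (false ∷_) (⊥++⊥≡⊥ a)

⊤++⊤≡⊤ : ∀ a {b} → ⊤ {a} ++ ⊤ {b} ≡ ⊤
⊤++⊤≡⊤ zero    = refl
⊤++⊤≡⊤ (suc a) = cong (true ∷_) (⊤++⊤≡⊤ a)

∣p∣≤1 : ∀ {n} (p : Subset n) → (∀ {x y} → x ∈ p → y ∈ p → x ≡ y) → ∣ p ∣ ≤ 1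
∣p∣≤1 []          _     = z≤n
∣p∣≤1 {suc n} (true ∷ p) all-equal = s≤s (≤-reflexive (trans (cong ∣_∣ p≡⊥) (∣⊥∣≡0 n)))
  where
  p≡⊥ : p ≡ ⊥
  p≡⊥ = Empty-unique λ { (_ , x∈p) → Finₚ.0≢1+n (all-equal here (there x∈p)) }
∣p∣≤1 (false ∷ p) all-equal = ∣p∣≤1 p (λ x∈p y∈p → Finₚ.suc-injective (all-equal (there x∈p) (there y∈p)))

module _ {k m} (F : Fin k → Subset m) where

  containing : Fin m → Subset k
  containing x = tabulate (λ i → lookup (F i) x)

  ∈-containing⁺ : ∀ {i x} → x ∈ F i → i ∈ containing x
  ∈-containing⁺ {i} {x} x∈Fi =
    lookup⇒[]= i _ (trans (lookup∘tabulate (λ j → lookup (F j) x) i) ([]=⇒lookup x∈Fi))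

  ∈-containing⁻ : ∀ {i x} → i ∈ containing x → x ∈ F i
  ∈-containing⁻ {i} {x} i∈Sx =
    lookup⇒[]= x (F i) (trans (sym (lookup∘tabulate (λ j → lookup (F j) x) i)) ([]=⇒lookup i∈Sx))

∈-bigUnion⁺ : ∀ {k m} (F : Fin k → Subset m) Γ {i x} → i ∈ Γ → x ∈ F i → x ∈ bigUnion F Γ
∈-bigUnion⁺ F (true  ∷ Γ) here        x∈Fi = x∈p∪q⁺ (inj₁ x∈Fi)
∈-bigUnion⁺ F (true  ∷ Γ) (there i∈Γ) x∈Fi = x∈p∪q⁺ (inj₂ (∈-bigUnion⁺ (F ∘ fsuc) Γ i∈Γ x∈Fi))
∈-bigUnion⁺ F (false ∷ Γ) (there i∈Γ) x∈Fi = ∈-bigUnion⁺ (F ∘ fsuc) Γ i∈Γ x∈Fi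

∈-bigUnion⁻ : ∀ {k m} (F : Fin k → Subset m) Γ {x} → x ∈ bigUnion F Γ → ∃[ i ] i ∈ Γ × x ∈ F i
∈-bigUnion⁻ {zero} F [] x∈⊥ = contradiction x∈⊥ ∉⊥
∈-bigUnion⁻ {suc k} F (true ∷ Γ) x∈⋃ with x∈p∪q⁻ (F fzero) _ x∈⋃
... | inj₁ x∈F0 = fzero , here , x∈F0
... | inj₂ x∈⋃′ with ∈-bigUnion⁻ (F ∘ fsuc) Γ x∈⋃′
...   | i , i∈Γ , x∈Fi = fsuc i , there i∈Γ , x∈Fi
∈-bigUnion⁻ {suc k} F (false ∷ Γ) x∈⋃ with ∈-bigUnion⁻ (F ∘ fsuc) Γ x∈⋃
... | i , i∈Γ , x∈Fi = fsuc i , there i∈Γ , x∈Fi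

∈-bigInter⁺ : ∀ {k m} (F : Fin k → Subset m) Γ {x} → (∀ {i} → i ∈ Γ → x ∈ F i) → x ∈ bigInter F Γ
∈-bigInter⁺ {zero}  F []          _   = ∈⊤
∈-bigInter⁺ {suc k} F (true  ∷ Γ) x∈F = x∈p∩q⁺ (x∈F here , ∈-bigInter⁺ (F ∘ fsuc) Γ (x∈F ∘ there))
∈-bigInter⁺ {suc k} F (false ∷ Γ) x∈F = ∈-bigInter⁺ (F ∘ fsuc) Γ (x∈F ∘ there)

∈-bigInter⁻ : ∀ {k m} (F : Fin k → Subset m) Γ {i x} → x ∈ bigInter F Γ → i ∈ Γ → x ∈ F i
∈-bigInter⁻ F (true  ∷ Γ) x∈⋂ here        = proj₁ (x∈p∩q⁻ (F fzero) _ x∈⋂)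
∈-bigInter⁻ F (true  ∷ Γ) x∈⋂ (there i∈Γ) = ∈-bigInter⁻ (F ∘ fsuc) Γ (proj₂ (x∈p∩q⁻ (F fzero) _ x∈⋂)) i∈Γ
∈-bigInter⁻ F (false ∷ Γ) x∈⋂ (there i∈Γ) = ∈-bigInter⁻ (F ∘ fsuc) Γ x∈⋂ i∈Γ

∉-bigInter⁻ : ∀ {k m} (F : Fin k → Subset m) Γ {x} → x ∉ bigInter F Γ → ∃[ i ] i ∈ Γ × x ∉ F i
∉-bigInter⁻ F Γ {x} x∉⋂ with ⊈⇒∃∈∉ {q = containing F x} (λ Γ⊆Sx → x∉⋂ (∈-bigInter⁺ F Γ (∈-containing⁻ F ∘ Γ⊆Sx)))
... | i , i∈Γ , i∉Sx = i , i∈Γ , i∉Sx ∘ ∈-containing⁺ F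

module _ {k m} (F : Fin k → Subset m) where

  bigUnion-mono : ∀ {Γ Δ} → Γ ⊆ Δ → bigUnion F Γ ⊆ bigUnion F Δ
  bigUnion-mono {Γ} {Δ} Γ⊆Δ x∈⋃ with ∈-bigUnion⁻ F Γ x∈⋃
  ... | i , i∈Γ , x∈Fi = ∈-bigUnion⁺ F Δ (Γ⊆Δ i∈Γ) x∈Fi

  bigInter-antitone : ∀ {Γ Δ} → Γ ⊆ Δ → bigInter F Δ ⊆ bigInter F Γ
  bigInter-antitone {Γ} {Δ} Γ⊆Δ x∈⋂ = ∈-bigInter⁺ F Γ (∈-bigInter⁻ F Δ x∈⋂ ∘ Γ⊆Δ)

  bigInter⊆bigUnion : ∀ {Γ} → Nonempty Γ → bigInter F Γ ⊆ bigUnion F Γ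
  bigInter⊆bigUnion {Γ} (i , i∈Γ) x∈⋂ = ∈-bigUnion⁺ F Γ i∈Γ (∈-bigInter⁻ F Γ x∈⋂ i∈Γ)

  bigUnion⊆bigInter⇒∣Γ∣≤1 : Injective _≡_ _≡_ F → ∀ {Γ} → bigUnion F Γ ⊆ bigInter F Γ → ∣ Γ ∣ ≤ 1
  bigUnion⊆bigInter⇒∣Γ∣≤1 F-injective {Γ} ⋃⊆⋂ =
    ∣p∣≤1 Γ (λ i∈Γ j∈Γ → F-injective (⊆-antisym (Fi⊆Fj i∈Γ j∈Γ) (Fi⊆Fj j∈Γ i∈Γ)))
    where
    Fi⊆Fj : ∀ {i j} → i ∈ Γ → j ∈ Γ → F i ⊆ F j
    Fi⊆Fj i∈Γ j∈Γ x∈Fi = ∈-bigInter⁻ F Γ (⋃⊆⋂ (∈-bigUnion⁺ F Γ i∈Γ x∈Fi)) j∈Γ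

module _ {k m} {p : Subset m} {Γ : Subset k} where

  bigUnion-const : Nonempty Γ → bigUnion (λ _ → p) Γ ≡ p
  bigUnion-const (i , i∈Γ) =
    ⊆-antisym (λ x∈⋃ → proj₂ (proj₂ (∈-bigUnion⁻ _ Γ x∈⋃))) (∈-bigUnion⁺ _ Γ i∈Γ)

  bigInter-const : Nonempty Γ → bigInter (λ _ → p) Γ ≡ p
  bigInter-const (i , i∈Γ) =
    ⊆-antisym (λ x∈⋂ → ∈-bigInter⁻ _ Γ x∈⋂ i∈Γ) (λ x∈p → ∈-bigInter⁺ _ Γ (λ _ → x∈p))

module _ {k m} (F : Fin k → Subset m) (Γ : Subset k) where

  bigUnion-∁ : bigUnion (∁ ∘ F) Γ ≡ ∁ (bigInter F Γ)
  bigUnion-∁ = ⊆-antisym ⊆∁ ∁⊆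
    where
    ⊆∁ : bigUnion (∁ ∘ F) Γ ⊆ ∁ (bigInter F Γ)
    ⊆∁ x∈⋃ with ∈-bigUnion⁻ (∁ ∘ F) Γ x∈⋃
    ... | i , i∈Γ , x∈∁Fi = x∉p⇒x∈∁p (λ x∈⋂ → x∈∁p⇒x∉p x∈∁Fi (∈-bigInter⁻ F Γ x∈⋂ i∈Γ))
    ∁⊆ : ∁ (bigInter F Γ) ⊆ bigUnion (∁ ∘ F) Γ
    ∁⊆ x∈∁⋂ with ∉-bigInter⁻ F Γ (x∈∁p⇒x∉p x∈∁⋂)
    ... | i , i∈Γ , x∉Fi = ∈-bigUnion⁺ (∁ ∘ F) Γ i∈Γ (x∉p⇒x∈∁p x∉Fi)

  bigInter-∁ : bigInter (∁ ∘ F) Γ ≡ ∁ (bigUnion F Γ)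
  bigInter-∁ = ⊆-antisym ⊆∁ ∁⊆
    where
    ⊆∁ : bigInter (∁ ∘ F) Γ ⊆ ∁ (bigUnion F Γ)
    ⊆∁ x∈⋂ = x∉p⇒x∈∁p λ x∈⋃ → case ∈-bigUnion⁻ F Γ x∈⋃ of
      λ { (i , i∈Γ , x∈Fi) → x∈∁p⇒x∉p (∈-bigInter⁻ (∁ ∘ F) Γ x∈⋂ i∈Γ) x∈Fi }
    ∁⊆ : ∁ (bigUnion F Γ) ⊆ bigInter (∁ ∘ F) Γ
    ∁⊆ x∈∁⋃ = ∈-bigInter⁺ (∁ ∘ F) Γ λ i∈Γ → x∉p⇒x∈∁p (x∈∁p⇒x∉p x∈∁⋃ ∘ ∈-bigUnion⁺ F Γ i∈Γ)

bigUnion-++ : ∀ {k a b} (P : Fin k → Subset a) (Q : Fin k → Subset b) Γ →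
              bigUnion (λ i → P i ++ Q i) Γ ≡ bigUnion P Γ ++ bigUnion Q Γ
bigUnion-++ {zero} {a} P Q []          = sym (⊥++⊥≡⊥ a)
bigUnion-++ {suc k} P Q (true  ∷ Γ) =
  trans (cong ((P fzero ++ Q fzero) ∪_) (bigUnion-++ (P ∘ fsuc) (Q ∘ fsuc) Γ)) (zipWith-++ _ (P fzero) (Q fzero) _ _)
bigUnion-++ {suc k} P Q (false ∷ Γ) = bigUnion-++ (P ∘ fsuc) (Q ∘ fsuc) Γ

bigInter-++ : ∀ {k a b} (P : Fin k → Subset a) (Q : Fin k → Subset b) Γ →
              bigInter (λ i → P i ++ Q i) Γ ≡ bigInter P Γ ++ bigInter Q Γ
bigInter-++ {zero} {a} P Q []          = sym (⊤++⊤≡⊤ a)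
bigInter-++ {suc k} P Q (true  ∷ Γ) =
  trans (cong ((P fzero ++ Q fzero) ∩_) (bigInter-++ (P ∘ fsuc) (Q ∘ fsuc) Γ)) (zipWith-++ _ (P fzero) (Q fzero) _ _)
bigInter-++ {suc k} P Q (false ∷ Γ) = bigInter-++ (P ∘ fsuc) (Q ∘ fsuc) Γ

module SplitAt {k m} (F : Fin k → Subset m) {Γ x} (x∈⋃ : x ∈ bigUnion F Γ) (x∉⋂ : x ∉ bigInter F Γ) where

  Γ⁺ Γ⁻ : Subset k
  Γ⁺ = Γ ∩ containing F x
  Γ⁻ = Γ ∩ ∁ (containing F x)

  Γ⁺⊆Γ : Γ⁺ ⊆ Γ
  Γ⁺⊆Γ = p∩q⊆p Γ _

  Γ⁻⊆Γ : Γ⁻ ⊆ Γ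
  Γ⁻⊆Γ = p∩q⊆p Γ _

  Γ⁺-nonempty : Nonempty Γ⁺
  Γ⁺-nonempty with ∈-bigUnion⁻ F Γ x∈⋃
  ... | i , i∈Γ , x∈Fi = i , x∈p∩q⁺ (i∈Γ , ∈-containing⁺ F x∈Fi)

  Γ⁻-nonempty : Nonempty Γ⁻
  Γ⁻-nonempty with ∉-bigInter⁻ F Γ x∉⋂
  ... | i , i∈Γ , x∉Fi = i , x∈p∩q⁺ (i∈Γ , x∉p⇒x∈∁p (x∉Fi ∘ ∈-containing⁻ F))

  x∈⋂Γ⁺ : x ∈ bigInter F Γ⁺
  x∈⋂Γ⁺ = ∈-bigInter⁺ F Γ⁺ (∈-containing⁻ F ∘ p∩q⊆q Γ _)

  x∉⋃Γ⁻ : x ∉ bigUnion F Γ⁻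
  x∉⋃Γ⁻ x∈⋃Γ⁻ with ∈-bigUnion⁻ F Γ⁻ x∈⋃Γ⁻
  ... | i , i∈Γ⁻ , x∈Fi = x∈∁p⇒x∉p (p∩q⊆q Γ _ i∈Γ⁻) (∈-containing⁺ F x∈Fi)

  ∣⋃Γ⁻∣<∣⋃Γ∣ : ∣ bigUnion F Γ⁻ ∣ < ∣ bigUnion F Γ ∣
  ∣⋃Γ⁻∣<∣⋃Γ∣ = p⊂q⇒∣p∣<∣q∣ (bigUnion-mono F Γ⁻⊆Γ , x , x∈⋃ , x∉⋃Γ⁻)

  ∣Γ∣≡∣Γ⁺∣+∣Γ⁻∣ : ∣ Γ ∣ ≡ ∣ Γ⁺ ∣ + ∣ Γ⁻ ∣
  ∣Γ∣≡∣Γ⁺∣+∣Γ⁻∣ = ∣p∣≡∣p∩q∣+∣p∩∁q∣ Γ (containing F x)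

2^[u₁∸α]+2^[u₀∸α]≤2^[u∸α] : ∀ {u₁ u₀ u α} → u₁ < u → u₀ < u → α < u →
                             2 ^ (u₁ ∸ α) + 2 ^ (u₀ ∸ α) ≤ 2 ^ (u ∸ α)
2^[u₁∸α]+2^[u₀∸α]≤2^[u∸α] {u₁} {u₀} {suc v} {α} (s≤s u₁≤v) (s≤s u₀≤v) (s≤s α≤v) = begin
  2 ^ (u₁ ∸ α) + 2 ^ (u₀ ∸ α) ≤⟨ +-mono-≤ (2^-mono (∸-monoˡ-≤ α u₁≤v)) (2^-mono (∸-monoˡ-≤ α u₀≤v)) ⟩
  2 ^ (v ∸ α) + 2 ^ (v ∸ α)   ≡⟨ cong (2 ^ (v ∸ α) +_) (sym (+-identityʳ _)) ⟩
  2 ^ suc (v ∸ α)             ≡⟨ cong (2 ^_) (sym (+-∸-assoc 1 α≤v)) ⟩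
  2 ^ (suc v ∸ α)             ∎
  where
  open ≤-Reasoning
  2^-mono : ∀ {a b} → a ≤ b → 2 ^ a ≤ 2 ^ b
  2^-mono = ^-monoʳ-≤ 2

module HKEBound {k m} (F : Fin k → Subset m) (α : ℕ) (F-injective : Injective _≡_ _≡_ F)
  (hke : ∀ Γ → Nonempty Γ → ∣ bigUnion F Γ ∣ + ∣ bigInter F Γ ∣ ≡ 2 * α) where

  α<∣⋃∣ : ∀ {Γ} → Nonempty Γ → bigInter F Γ ⊂ bigUnion F Γ → α < ∣ bigUnion F Γ ∣
  α<∣⋃∣ {Γ} Γ≢∅ ⋂⊂⋃ = *-cancelˡ-< 2 α ∣⋃∣ (begin-strict
    2 * α        ≡⟨ sym (hke Γ Γ≢∅) ⟩
    ∣⋃∣ + ∣⋂∣    <⟨ +-monoʳ-< ∣⋃∣ (p⊂q⇒∣p∣<∣q∣ ⋂⊂⋃) ⟩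
    ∣⋃∣ + ∣⋃∣    ≡⟨ cong (∣⋃∣ +_) (sym (+-identityʳ ∣⋃∣)) ⟩
    2 * ∣⋃∣      ∎)
    where
    open ≤-Reasoning
    ∣⋃∣ = ∣ bigUnion F Γ ∣
    ∣⋂∣ = ∣ bigInter F Γ ∣

  -- Equal unions would force, by the hke identity, equal intersections.
  bigInter-⊂⇒∣bigUnion∣-< : ∀ {Γ Δ} → Γ ⊆ Δ → Nonempty Γ → Nonempty Δ →
                              bigInter F Δ ⊂ bigInter F Γ → ∣ bigUnion F Γ ∣ < ∣ bigUnion F Δ ∣
  bigInter-⊂⇒∣bigUnion∣-< {Γ} {Δ} Γ⊆Δ Γ≢∅ Δ≢∅ ⋂Δ⊂⋂Γ =
    ≤∧≢⇒< (p⊆q⇒∣p∣≤∣q∣ (bigUnion-mono F Γ⊆Δ)) λ ∣⋃Γ∣≡∣⋃Δ∣ →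
      <⇒≢ (p⊂q⇒∣p∣<∣q∣ ⋂Δ⊂⋂Γ) (+-cancelˡ-≡ ∣ bigUnion F Δ ∣ _ _ (begin
        ∣ bigUnion F Δ ∣ + ∣ bigInter F Δ ∣ ≡⟨ hke Δ Δ≢∅ ⟩
        2 * α                               ≡⟨ sym (hke Γ Γ≢∅) ⟩
        ∣ bigUnion F Γ ∣ + ∣ bigInter F Γ ∣ ≡⟨ cong (_+ ∣ bigInter F Γ ∣) ∣⋃Γ∣≡∣⋃Δ∣ ⟩
        ∣ bigUnion F Δ ∣ + ∣ bigInter F Γ ∣ ∎))
    where open ≡-Reasoning

  ∣Γ∣≤2^[∣⋃Γ∣∸α] : ∀ Γ → Nonempty Γ → ∣ Γ ∣ ≤ 2 ^ (∣ bigUnion F Γ ∣ ∸ α)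
  ∣Γ∣≤2^[∣⋃Γ∣∸α] Γ = <-rec Bound step _ Γ refl
    where
    Bound : ℕ → Set
    Bound u = ∀ Γ → ∣ bigUnion F Γ ∣ ≡ u → Nonempty Γ → ∣ Γ ∣ ≤ 2 ^ (u ∸ α)

    step : ∀ u → (∀ {v} → v < u → Bound v) → Bound u
    step _ rec Γ refl Γ≢∅ with bigUnion F Γ ⊆? bigInter F Γ
    ... | yes ⋃⊆⋂ = ≤-trans (bigUnion⊆bigInter⇒∣Γ∣≤1 F F-injective ⋃⊆⋂) (m^n>0 2 (∣ bigUnion F Γ ∣ ∸ α))
    ... | no ⋃⊈⋂ with ⊈⇒∃∈∉ ⋃⊈⋂
    ...   | x , x∈⋃ , x∉⋂ = begin
      ∣ Γ ∣                                ≡⟨ ∣Γ∣≡∣Γ⁺∣+∣Γ⁻∣ ⟩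
      ∣ Γ⁺ ∣ + ∣ Γ⁻ ∣                       ≤⟨ +-mono-≤ (rec ∣⋃Γ⁺∣<∣⋃Γ∣ Γ⁺ refl Γ⁺-nonempty)
                                                         (rec ∣⋃Γ⁻∣<∣⋃Γ∣ Γ⁻ refl Γ⁻-nonempty) ⟩
      2 ^ (∣ bigUnion F Γ⁺ ∣ ∸ α) + 2 ^ (∣ bigUnion F Γ⁻ ∣ ∸ α)
                                           ≤⟨ 2^[u₁∸α]+2^[u₀∸α]≤2^[u∸α] ∣⋃Γ⁺∣<∣⋃Γ∣ ∣⋃Γ⁻∣<∣⋃Γ∣ α<∣⋃Γ∣ ⟩
      2 ^ (∣ bigUnion F Γ ∣ ∸ α)           ∎
      where
      open ≤-Reasoning
      open SplitAt F x∈⋃ x∉⋂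
      ∣⋃Γ⁺∣<∣⋃Γ∣ : ∣ bigUnion F Γ⁺ ∣ < ∣ bigUnion F Γ ∣
      ∣⋃Γ⁺∣<∣⋃Γ∣ = bigInter-⊂⇒∣bigUnion∣-< Γ⁺⊆Γ Γ⁺-nonempty Γ≢∅
                     (bigInter-antitone F Γ⁺⊆Γ , x , x∈⋂Γ⁺ , x∉⋂)
      α<∣⋃Γ∣ : α < ∣ bigUnion F Γ ∣
      α<∣⋃Γ∣ = α<∣⋃∣ Γ≢∅ (bigInter⊆bigUnion F Γ≢∅ , x , x∈⋃ , x∉⋂)

hke-size-bound : ∀ {k m} (F : Fin k → Subset m) {α} → IsHKEWith F α → k ≤ 2 ^ (unionSize F ∸ α)
hke-size-bound {suc k} F {α} (F-injective , _ , _ , hke) =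
  subst (_≤ 2 ^ (unionSize F ∸ α)) (∣⊤∣≡n (suc k)) (HKEBound.∣Γ∣≤2^[∣⋃Γ∣∸α] F α F-injective hke ⊤ (fzero , ∈⊤))

funToFin-cong : ∀ {a b} {f g : Fin a → Fin b} → f ≗ g → funToFin f ≡ funToFin g
funToFin-cong {zero}  _   = refl
funToFin-cong {suc a} f≗g = cong₂ combine (f≗g fzero) (funToFin-cong (f≗g ∘ fsuc))

module _ (d : ℕ) where
  open Inverse 2↔Bool using (to; from; strictlyInverseˡ; strictlyInverseʳ)

  subsetAt : Fin (2 ^ d) → Subset d
  subsetAt i = tabulate (to ∘ finToFun i)

  indexOf : Subset d → Fin (2 ^ d)
  indexOf p = funToFin (from ∘ lookup p)

  subsetAt-indexOf : ∀ p → subsetAt (indexOf p) ≡ p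
  subsetAt-indexOf p = trans
    (tabulate-cong λ j → trans (cong to (finToFun-funToFin (from ∘ lookup p) j)) (strictlyInverseˡ (lookup p j)))
    (tabulate∘lookup p)

  indexOf-subsetAt : ∀ i → indexOf (subsetAt i) ≡ i
  indexOf-subsetAt i = trans
    (funToFin-cong {d} λ j → trans (cong from (lookup∘tabulate (to ∘ finToFun i) j)) (strictlyInverseʳ (finToFun i j)))
    (funToFin-finToFin {d} i)

  subsetAt-injective : Injective _≡_ _≡_ subsetAt
  subsetAt-injective {i} {j} eq = trans (sym (indexOf-subsetAt i)) (trans (cong indexOf eq) (indexOf-subsetAt j))

  bigUnion-subsetAt : bigUnion subsetAt ⊤ ≡ ⊤
  bigUnion-subsetAt = ⊆-antisym ⊆⊤
    (subst (_⊆ bigUnion subsetAt ⊤) (subsetAt-indexOf ⊤) (∈-bigUnion⁺ subsetAt ⊤ ∈⊤))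

  bigInter-subsetAt : bigInter subsetAt ⊤ ≡ ⊥
  bigInter-subsetAt = ⊆-antisym
    (subst (bigInter subsetAt ⊤ ⊆_) (subsetAt-indexOf ⊥) (λ x∈⋂ → ∈-bigInter⁻ subsetAt ⊤ x∈⋂ ∈⊤)) ⊥⊆

∣⊤++p++∁q∣ : ∀ c {d} (p q : Subset d) → ∣ ⊤ {c} ++ (p ++ ∁ q) ∣ ≡ c + (∣ p ∣ + (d ∸ ∣ q ∣))
∣⊤++p++∁q∣ c p q = begin
  ∣ ⊤ {c} ++ (p ++ ∁ q) ∣      ≡⟨ ∣p++q∣≡∣p∣+∣q∣ (⊤ {c}) (p ++ ∁ q) ⟩
  ∣ ⊤ {c} ∣ + ∣ p ++ ∁ q ∣     ≡⟨ cong₂ _+_ (∣⊤∣≡n c) (∣p++q∣≡∣p∣+∣q∣ p (∁ q)) ⟩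
  c + (∣ p ∣ + ∣ ∁ q ∣)        ≡⟨ cong (λ n → c + (∣ p ∣ + n)) (∣∁p∣≡n∸∣p∣ q) ⟩
  c + (∣ p ∣ + (_ ∸ ∣ q ∣))    ∎
  where open ≡-Reasoning

complemented : ∀ {k d} c → (Fin k → Subset d) → Fin k → Subset (c + (d + d))
complemented c B i = ⊤ {c} ++ (B i ++ ∁ (B i))

module _ {k d} (c : ℕ) (B : Fin k → Subset d) where

  complemented-injective : Injective _≡_ _≡_ B → Injective _≡_ _≡_ (complemented c B)
  complemented-injective B-injective {i} {j} eq =
    B-injective (proj₁ (++-injective (B i) (B j) (proj₂ (++-injective (⊤ {c}) ⊤ eq))))

  bigUnion-complemented : ∀ {Γ} → Nonempty Γ →
                          bigUnion (complemented c B) Γ ≡ ⊤ {c} ++ (bigUnion B Γ ++ ∁ (bigInter B Γ))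
  bigUnion-complemented {Γ} Γ≢∅ = begin
    bigUnion (complemented c B) Γ
      ≡⟨ bigUnion-++ (λ _ → ⊤) _ Γ ⟩
    bigUnion (λ _ → ⊤ {c}) Γ ++ bigUnion (λ i → B i ++ ∁ (B i)) Γ
      ≡⟨ cong₂ _++_ (bigUnion-const Γ≢∅) (bigUnion-++ B (∁ ∘ B) Γ) ⟩
    ⊤ {c} ++ (bigUnion B Γ ++ bigUnion (∁ ∘ B) Γ)
      ≡⟨ cong (λ X → ⊤ {c} ++ (bigUnion B Γ ++ X)) (bigUnion-∁ B Γ) ⟩
    ⊤ {c} ++ (bigUnion B Γ ++ ∁ (bigInter B Γ))
      ∎
    where open ≡-Reasoning

  bigInter-complemented : ∀ {Γ} → Nonempty Γ →
                          bigInter (complemented c B) Γ ≡ ⊤ {c} ++ (bigInter B Γ ++ ∁ (bigUnion B Γ))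
  bigInter-complemented {Γ} Γ≢∅ = begin
    bigInter (complemented c B) Γ
      ≡⟨ bigInter-++ (λ _ → ⊤) _ Γ ⟩
    bigInter (λ _ → ⊤ {c}) Γ ++ bigInter (λ i → B i ++ ∁ (B i)) Γ
      ≡⟨ cong₂ _++_ (bigInter-const Γ≢∅) (bigInter-++ B (∁ ∘ B) Γ) ⟩
    ⊤ {c} ++ (bigInter B Γ ++ bigInter (∁ ∘ B) Γ)
      ≡⟨ cong (λ X → ⊤ {c} ++ (bigInter B Γ ++ X)) (bigInter-∁ B Γ) ⟩
    ⊤ {c} ++ (bigInter B Γ ++ ∁ (bigUnion B Γ))
      ∎
    where open ≡-Reasoning

  complemented-hke : ∀ Γ → Nonempty Γ →
    ∣ bigUnion (complemented c B) Γ ∣ + ∣ bigInter (complemented c B) Γ ∣ ≡ 2 * (c + d)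
  complemented-hke Γ Γ≢∅ = begin
    ∣ bigUnion (complemented c B) Γ ∣ + ∣ bigInter (complemented c B) Γ ∣
      ≡⟨ cong₂ (λ X Y → ∣ X ∣ + ∣ Y ∣) (bigUnion-complemented Γ≢∅) (bigInter-complemented Γ≢∅) ⟩
    ∣ ⊤ {c} ++ (bigUnion B Γ ++ ∁ (bigInter B Γ)) ∣ + ∣ ⊤ {c} ++ (bigInter B Γ ++ ∁ (bigUnion B Γ)) ∣
      ≡⟨ cong₂ _+_ (∣⊤++p++∁q∣ c (bigUnion B Γ) _) (∣⊤++p++∁q∣ c (bigInter B Γ) _) ⟩
    (c + (u + (d ∸ i))) + (c + (i + (d ∸ u)))
      ≡⟨ solve 5 (λ c u i u′ i′ → (c :+ (u :+ i′)) :+ (c :+ (i :+ u′)) := (c :+ c) :+ ((u :+ u′) :+ (i :+ i′)))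
               refl c u i (d ∸ u) (d ∸ i) ⟩
    (c + c) + ((u + (d ∸ u)) + (i + (d ∸ i)))
      ≡⟨ cong₂ (λ a b → (c + c) + (a + b)) (m+[n∸m]≡n (∣p∣≤n (bigUnion B Γ))) (m+[n∸m]≡n (∣p∣≤n (bigInter B Γ))) ⟩
    (c + c) + (d + d)
      ≡⟨ solve 2 (λ c d → (c :+ c) :+ (d :+ d) := con 2 :* (c :+ d)) refl c d ⟩
    2 * (c + d) ∎
    where
    open ≡-Reasoning
    open +-*-Solver
    u = ∣ bigUnion B Γ ∣
    i = ∣ bigInter B Γ ∣

unionSize-complemented-subsetAt : ∀ c d → unionSize (complemented c (subsetAt d)) ≡ c + (d + d)
unionSize-complemented-subsetAt c d = begin
  ∣ bigUnion (complemented c S) ⊤ ∣               ≡⟨ cong ∣_∣ (bigUnion-complemented c S (indexOf d ⊤ , ∈⊤)) ⟩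
  ∣ ⊤ {c} ++ (bigUnion S ⊤ ++ ∁ (bigInter S ⊤)) ∣ ≡⟨ ∣⊤++p++∁q∣ c (bigUnion S ⊤) (bigInter S ⊤) ⟩
  c + (∣ bigUnion S ⊤ ∣ + (d ∸ ∣ bigInter S ⊤ ∣)) ≡⟨ cong₂ (λ a b → c + (a + (d ∸ b))) ∣⋃S∣≡d ∣⋂S∣≡0 ⟩
  c + (d + d)                                     ∎
  where
  open ≡-Reasoning
  S : Fin (2 ^ d) → Subset d
  S = subsetAt d
  ∣⋃S∣≡d : ∣ bigUnion S ⊤ ∣ ≡ d
  ∣⋃S∣≡d = trans (cong ∣_∣ (bigUnion-subsetAt d)) (∣⊤∣≡n d)
  ∣⋂S∣≡0 : ∣ bigInter S ⊤ ∣ ≡ 0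
  ∣⋂S∣≡0 = trans (cong ∣_∣ (bigInter-subsetAt d)) (∣⊥∣≡0 d)

mainTheorem6 : (α n : ℕ) → α ≥ 1 → α ≤ n → n ≤ 2 * α →
    (Σ ℕ λ m → Σ (Fin (2 ^ (n ∸ α)) → Subset m) λ F →
        IsHKEWith F α × unionSize F ≡ n)
    × (∀ {k m} (F : Fin k → Subset m) → IsHKEWith F α → unionSize F ≡ n →
        k ≤ 2 ^ (n ∸ α))
mainTheorem6 α n α≥1 α≤n n≤2α =
  (c + (d + d) , F , (F-injective , m^n>0 2 d , α≥1 , F-hke) , ∣⋃F∣≡n) , upper-bound
  where
  d = n ∸ α
  c = α ∸ d

  c+d≡α : c + d ≡ α
  c+d≡α = m∸n+n≡m (m≤n+o⇒m∸n≤o n α (≤-trans n≤2α (≤-reflexive (cong (α +_) (+-identityʳ α)))))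

  F : Fin (2 ^ d) → Subset (c + (d + d))
  F = complemented c (subsetAt d)

  F-injective : Injective _≡_ _≡_ F
  F-injective = complemented-injective c (subsetAt d) (subsetAt-injective d)

  F-hke : ∀ Γ → Nonempty Γ → ∣ bigUnion F Γ ∣ + ∣ bigInter F Γ ∣ ≡ 2 * α
  F-hke Γ Γ≢∅ = trans (complemented-hke c (subsetAt d) Γ Γ≢∅) (cong (2 *_) c+d≡α)

  ∣⋃F∣≡n : unionSize F ≡ n
  ∣⋃F∣≡n = begin
    unionSize F  ≡⟨ unionSize-complemented-subsetAt c d ⟩
    c + (d + d)  ≡⟨ sym (+-assoc c d d) ⟩
    c + d + d    ≡⟨ cong (_+ d) c+d≡α ⟩
    α + (n ∸ α)  ≡⟨ m+[n∸m]≡n α≤n ⟩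
    n            ∎
    where open ≡-Reasoning

  upper-bound : ∀ {k m} (G : Fin k → Subset m) → IsHKEWith G α → unionSize G ≡ n → k ≤ 2 ^ (n ∸ α)
  upper-bound G G-hke ∣⋃G∣≡n = subst (λ u → _ ≤ 2 ^ (u ∸ α)) ∣⋃G∣≡n (hke-size-bound G G-hke)
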